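{- Let $\vec G$ be a connected oriented graph with at least two vertices, and let $u$ be a source or a sink of $\vec G$. Then $u$ belongs to every MAG-set of $\vec G$.
   Context: A vertex is a source if it has no in-neighbour and a sink if it has no out-neighbour. Two distinct vertices $x,y$ monitor an arc $a$ if $a$ lies on every shortest directed path from $x$ to $y$, or on every shortest directed path from $y$ to $x$. A monitoring arc-geodetic set (MAG-set) of $\vec G$ is a set $M\subseteq V(\vec G)$ such that every arc is monitored by some pair of distinct vertices of $M$. -}

module Defs where

open import Level using (0ℓ)
open import Data.Nat using (ℕ; zero; suc; _≤_)
open import Data.Fin using (Fin)
open import Data.Fin.Subset using (Subset; _∈_)
open import Data.Product using (Σ; ∃; _×_; _,_)
open import Data.Sum using (_⊎_)
open import Relation.Nullary using (¬_)
open import Relation.Binary.PropositionalEquality using (_≡_; _≢_)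

record OrientedGraph (n : ℕ) : Set₁ where
  field
    Arc        : Fin n → Fin n → Set
    irrefl     : ∀ x → ¬ Arc x x
    antisym    : ∀ x y → Arc x y → ¬ Arc y x

module _ {n : ℕ} (G : OrientedGraph n) where
  open OrientedGraph G

  data Walk : Fin n → Fin n → ℕ → Set where
    nil  : ∀ {x} → Walk x x zero
    cons : ∀ {x y z k} → Arc x y → Walk y z k → Walk x z (suc k)

  data ArcOn (a b : Fin n) : ∀ {x y k} → Walk x y k → Set where
    here  : ∀ {z k} (e : Arc a b) (w : Walk b z k) → ArcOn a b (cons e w)
    there : ∀ {x y z k} (e : Arc x y) {w : Walk y z k} →
            ArcOn a b w → ArcOn a b (cons e w)

  Shortest : ∀ {x y k} → Walk x y k → Set
  Shortest {x} {y} {k} _ = ∀ k' → Walk x y k' → k ≤ k'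

  data UWalk : Fin n → Fin n → Set where
    unil  : ∀ {x} → UWalk x x
    ucons : ∀ {x y z} → (Arc x y ⊎ Arc y x) → UWalk y z → UWalk x z

  Connected : Set
  Connected = ∀ x y → UWalk x y

  Source : Fin n → Set
  Source u = ∀ v → ¬ Arc v u

  Sink : Fin n → Set
  Sink u = ∀ v → ¬ Arc u v

  -- arc (a , b) lies on every shortest directed path from x to y
  -- (and such a path exists, i.e. y is reachable from x)
  OnAllShortest : Fin n → Fin n → Fin n → Fin n → Set
  OnAllShortest x y a b =
    (Σ ℕ λ k → Σ (Walk x y k) Shortest) ×
    (∀ k (w : Walk x y k) → Shortest w → ArcOn a b w)

  Monitors : Fin n → Fin n → Fin n → Fin n → Set
  Monitors x y a b =
    x ≢ y × (OnAllShortest x y a b ⊎ OnAllShortest y x a b)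

  IsMAGSet : Subset n → Set
  IsMAGSet M = ∀ a b → Arc a b →
    Σ (Fin n) λ x → Σ (Fin n) λ y → x ∈ M × y ∈ M × Monitors x y a b

{-# OPTIONS --safe #-}
module Submission where

-- A walk can never enter a source, so a walk traversing an arc out of a
-- source u starts at u; dually, a walk traversing an arc into a sink ends
-- there. Since the graph is connected with at least two vertices, u has an
-- incident arc, and whichever pair of M monitors it must contain u.

open import Defs
open import Data.Nat using (ℕ; _≤_; s≤s; z≤n)
open import Data.Fin using (Fin; zero; suc; _≟_)
open import Data.Fin.Subset using (Subset; _∈_)
open import Data.Sum using (_⊎_; inj₁; inj₂)
open import Data.Product using (∃; _,_)
open import Data.Empty using (⊥-elim)
open import Relation.Nullary using (yes; no)
open import Relation.Binary.PropositionalEquality using (_≡_; _≢_; refl)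

module _ {n : ℕ} (G : OrientedGraph n) where
  open OrientedGraph G

  source-arc-starts-walk : ∀ {a b x y k} {w : Walk G x y k} →
                           Source G a → ArcOn G a b w → x ≡ a
  source-arc-starts-walk src (here e w) = refl
  source-arc-starts-walk src (there e p) with source-arc-starts-walk src p
  ... | refl = ⊥-elim (src _ e)

  sink-arc-ends-walk : ∀ {a b x y k} {w : Walk G x y k} →
                       Sink G b → ArcOn G a b w → y ≡ b
  sink-arc-ends-walk snk (here e nil)         = refl
  sink-arc-ends-walk snk (here e (cons e′ w)) = ⊥-elim (snk _ e′)
  sink-arc-ends-walk snk (there e p)          = sink-arc-ends-walk snk p

  Monitors-source⇒endpoint : ∀ {x y a b} → Source G a →
                             Monitors G x y a b → x ≡ a ⊎ y ≡ a
  Monitors-source⇒endpoint src (_ , inj₁ ((k , w , sh) , onAll)) =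
    inj₁ (source-arc-starts-walk src (onAll k w sh))
  Monitors-source⇒endpoint src (_ , inj₂ ((k , w , sh) , onAll)) =
    inj₂ (source-arc-starts-walk src (onAll k w sh))

  Monitors-sink⇒endpoint : ∀ {x y a b} → Sink G b →
                           Monitors G x y a b → y ≡ b ⊎ x ≡ b
  Monitors-sink⇒endpoint snk (_ , inj₁ ((k , w , sh) , onAll)) =
    inj₁ (sink-arc-ends-walk snk (onAll k w sh))
  Monitors-sink⇒endpoint snk (_ , inj₂ ((k , w , sh) , onAll)) =
    inj₂ (sink-arc-ends-walk snk (onAll k w sh))

  source∈MAGSet : ∀ {M u v} → IsMAGSet G M → Source G u → Arc u v → u ∈ M
  source∈MAGSet mag src e with mag _ _ e
  ... | x , y , x∈M , y∈M , m with Monitors-source⇒endpoint src m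
  ...   | inj₁ refl = x∈M
  ...   | inj₂ refl = y∈M

  sink∈MAGSet : ∀ {M u v} → IsMAGSet G M → Sink G u → Arc v u → u ∈ M
  sink∈MAGSet mag snk e with mag _ _ e
  ... | x , y , x∈M , y∈M , m with Monitors-sink⇒endpoint snk m
  ...   | inj₁ refl = y∈M
  ...   | inj₂ refl = x∈M

  UWalk⇒incident-arc : ∀ {x y} → x ≢ y → UWalk G x y →
                       ∃ λ v → Arc x v ⊎ Arc v x
  UWalk⇒incident-arc x≢x unil     = ⊥-elim (x≢x refl)
  UWalk⇒incident-arc _ (ucons e _) = _ , e

  incident-arc : 2 ≤ n → Connected G → ∀ u → ∃ λ v → Arc u v ⊎ Arc v u
  incident-arc (s≤s (s≤s z≤n)) conn u with u ≟ zero
  ... | yes refl = UWalk⇒incident-arc (λ ()) (conn u (suc zero))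
  ... | no u≢0   = UWalk⇒incident-arc u≢0 (conn u zero)

proposition1 : (n : ℕ) → 2 ≤ n → (G : OrientedGraph n) → Connected G →
    (u : Fin n) → Source G u ⊎ Sink G u →
    (M : Subset n) → IsMAGSet G M → u ∈ M
proposition1 n 2≤n G conn u (inj₁ src) M mag with incident-arc G 2≤n conn u
... | v , inj₁ u→v = source∈MAGSet G mag src u→v
... | v , inj₂ v→u = ⊥-elim (src v v→u)
proposition1 n 2≤n G conn u (inj₂ snk) M mag with incident-arc G 2≤n conn u
... | v , inj₁ u→v = ⊥-elim (snk v u→v)
... | v , inj₂ v→u = sink∈MAGSet G mag snk v→u
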